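{- Let $p>3$ be a prime. Then $$\sum_{k=0}^{[\frac{p-1}6]}\frac{\binom{6k}{3k}}{(-64)^k}\equiv\begin{cases}\frac13\big((-1)^{[\frac{p+1}4]}+2(-1)^{\frac{p-1}2}\big)\pmod p&\text{if }3\mid p-1,\\ \frac13\big((-1)^{[\frac{p+1}4]}-(-1)^{\frac{p-1}2}\big)\pmod p&\text{if }3\mid p-2.\end{cases}$$
   Context: $[x]$ is the greatest integer not exceeding $x$. -}

module Defs where

open import Data.Nat as ℕ using (ℕ; zero; suc; NonZero)
open import Data.Nat.Properties using (m^n≢0)
open import Data.Nat.Combinatorics using (_C_)
open import Data.Integer as ℤ using (ℤ; +_; -[1+_])
open import Data.Integer.Divisibility using () renaming (_∣_ to _∣ℤ_)
open import Data.Rational as ℚ using (ℚ; ↥_; _/_)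

sgn : ℕ → ℤ
sgn e = -[1+ 0 ] ℤ.^ e

sumTo : ℕ → (ℕ → ℚ) → ℚ
sumTo zero    f = f 0
sumTo (suc n) f = sumTo n f ℚ.+ f (suc n)

-- binom(6k,3k) / (-64)^k  =  ((-1)^k * binom(6k,3k)) / 64^k
term : ℕ → ℚ
term k = _/_ (sgn k ℤ.* + ((6 ℕ.* k) C (3 ℕ.* k))) (64 ℕ.^ k) {{m^n≢0 64 k}}

-- congruence of rationals modulo p: p divides the numerator (in lowest
-- terms) of a - b
_≡_[modℚ_] : ℚ → ℚ → ℕ → Set
a ≡ b [modℚ p ] = (+ p) ∣ℤ (↥ (a ℚ.- b))

module Submission where

-- Write p = 2n + 1 = 2(h + m) + 1 with m = ⌊(p+1)/4⌋ ∈ {h, h + 1}, and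
-- K = ⌊n/3⌋ = ⌊(p-1)/6⌋.  Modulo p:
--   (1) C(2j, j) ≡ (-4)^j C(n, j) for j ≤ n (induction on j via the ratios of consecutive
--       binomial coefficients), so (-1)^k C(6k, 3k) ≡ 64^k C(n, 3k) and 64^K times the sum
--       is ≡ Σ_{k ≤ K} C(n, 3k), the full sum of row n over the multiples of 3;
--   (2) exactly, 3 Σ_k C(n, 3k) = 2^n + c₆ n with c₆ n = 2 cos(nπ/3) (Pascal's rule for
--       the three residue classes modulo 3);
--   (3) 2^n ≡ (-1)^m (Gauss's lemma for 2: in 2^n n! = 2 · 4 ⋯ 2n the factors above n are
--       congruent to minus the odd numbers up to n).
-- Hence the sum is ≡ ((-1)^m + c₆ n)/3, and c₆ n = 2 (-1)^n if 3 ∣ n (that is 3 ∣ p - 1),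
-- c₆ n = -(-1)^n if 3 ∣ n + 1 (that is 3 ∣ p - 2).  The congruence is first established for
-- the integer numerator of the sum over 64^K and then transferred to the reduced rational.

open import Defs
open import Data.Nat as ℕ using (ℕ; _∸_; _/_; _<_)
open import Data.Nat.Divisibility using (_∣_)
open import Data.Nat.Primality using (Prime)
open import Data.Integer as ℤ using (+_)
open import Data.Rational as ℚ using ()
open import Data.Product using (_×_)

module BinomialIdentities where
  open import Data.Nat using (suc; _+_; _*_; _∸_; _!; _≤_; s≤s)
  open import Data.Nat.Properties
  open import Data.Nat.DivMod using (_/_; m/n*n≡m)
  open import Data.Nat.Combinatorics using (_C_; nCk≡n!/k![n-k]!; k![n∸k]!∣n!; k>n⇒nCk≡0)
  open import Data.Nat.Tactic.RingSolver using (solve-∀)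
  open import Relation.Nullary using (yes; no)
  open import Relation.Binary.PropositionalEquality
  open ≡-Reasoning

  C-factorial : ∀ {n k} → k ≤ n → (n C k) * (k ! * (n ∸ k) !) ≡ n !
  C-factorial {n} {k} k≤n = begin
    (n C k) * d      ≡⟨ cong (_* d) (nCk≡n!/k![n-k]! k≤n) ⟩
    (n ! / d) * d    ≡⟨ m/n*n≡m (k![n∸k]!∣n! k≤n) ⟩
    n !              ∎
    where
    d = k ! * (n ∸ k) !
    instance _ = k !* (n ∸ k) !≢0

  C-factorial-+ : ∀ a b → ((a + b) C a) * (a ! * b !) ≡ (a + b) !
  C-factorial-+ a b = subst (λ t → ((a + b) C a) * (a ! * t !) ≡ (a + b) !)
                        (m+n∸m≡n a b) (C-factorial (m≤m+n a b))

  C-absorb : ∀ n k → suc k * (n C suc k) ≡ (n ∸ k) * (n C k)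
  C-absorb n k with k <? n
  ... | no k≮n = begin
    suc k * (n C suc k)  ≡⟨ cong (suc k *_) (k>n⇒nCk≡0 (s≤s (≮⇒≥ k≮n))) ⟩
    suc k * 0            ≡⟨ *-zeroʳ (suc k) ⟩
    0                    ≡⟨ cong (_* (n C k)) (m≤n⇒m∸n≡0 (≮⇒≥ k≮n)) ⟨
    (n ∸ k) * (n C k)    ∎
  ... | yes k<n = *-cancelʳ-≡ _ _ (k ! * j !) (begin
    suc k * (n C suc k) * (k ! * j !)   ≡⟨ regroup (suc k) (n C suc k) (k !) (j !) ⟩
    (n C suc k) * ((suc k) ! * j !)     ≡⟨ C-factorial k<n ⟩
    n !                                 ≡⟨ C-factorial (<⇒≤ k<n) ⟨
    (n C k) * (k ! * (n ∸ k) !)         ≡⟨ cong (λ t → (n C k) * (k ! * t !)) n∸k≡1+j ⟩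
    (n C k) * (k ! * (suc j * j !))     ≡⟨ regroup′ (suc j) (n C k) (k !) (j !) ⟩
    suc j * (n C k) * (k ! * j !)       ≡⟨ cong (λ t → t * (n C k) * (k ! * j !)) n∸k≡1+j ⟨
    (n ∸ k) * (n C k) * (k ! * j !)     ∎)
    where
    j = n ∸ suc k
    n∸k≡1+j : n ∸ k ≡ suc j
    n∸k≡1+j = +-∸-assoc 1 k<n
    instance _ = k !* j !≢0
    regroup : ∀ s x f g → s * x * (f * g) ≡ x * ((s * f) * g)
    regroup = solve-∀
    regroup′ : ∀ s x f g → x * (f * (s * g)) ≡ s * x * (f * g)
    regroup′ = solve-∀

  C-central : ∀ m → suc m * ((suc m + suc m) C suc m) ≡ 2 * suc (m + m) * ((m + m) C m)
  C-central m = *-cancelʳ-≡ _ _ (suc m * (m ! * m !)) (begin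
    suc m * B′ * (suc m * (m ! * m !))          ≡⟨ regroup (suc m) B′ (m !) ⟩
    B′ * ((suc m) ! * (suc m) !)                ≡⟨ C-factorial-+ (suc m) (suc m) ⟩
    (suc m + suc m) !                           ≡⟨ cong (λ t → suc t !) (+-suc m m) ⟩
    suc (suc (m + m)) * (suc (m + m) * (m + m) !)
      ≡⟨ cong (λ t → suc (suc (m + m)) * (suc (m + m) * t)) (C-factorial-+ m m) ⟨
    suc (suc (m + m)) * (suc (m + m) * (B * (m ! * m !)))
                                                ≡⟨ regroup′ m B (m ! * m !) ⟩
    2 * suc (m + m) * B * (suc m * (m ! * m !)) ∎)
    where
    B = (m + m) C m
    B′ = (suc m + suc m) C suc m
    instance _ = m*n≢0 (suc m) (m ! * m !) {{_}} {{m !* m !≢0}}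
    regroup : ∀ s x f → s * x * (s * (f * f)) ≡ x * ((s * f) * (s * f))
    regroup = solve-∀
    regroup′ : ∀ m x f → suc (suc (m + m)) * (suc (m + m) * (x * f)) ≡ 2 * suc (m + m) * x * (suc m * f)
    regroup′ = solve-∀

module PrimeNonDivisibility {P : ℕ} (P-prime : Prime P) where
  open import Data.Nat using (ℕ; zero; suc; _*_; _^_; _!; _<_; z<s; nonTrivial⇒n>1; >-nonZero)
  open import Data.Nat.Properties using (<-trans; n<1+n)
  open import Data.Nat.Divisibility using (_∣_; _∤_; >⇒∤)
  open import Data.Nat.Primality using (Prime; euclidsLemma)
  open import Data.Sum using ([_,_])
  open Prime P-prime using (nontrivial)

  ∤-small : ∀ {a} → 0 < a → a < P → P ∤ a
  ∤-small 0<a a<P = >⇒∤ {{>-nonZero 0<a}} a<P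

  ∤-1 : P ∤ 1
  ∤-1 = ∤-small z<s (nonTrivial⇒n>1 P)

  ∤-* : ∀ {a b} → P ∤ a → P ∤ b → P ∤ a * b
  ∤-* {a} {b} P∤a P∤b P∣ab = [ P∤a , P∤b ] (euclidsLemma a b P-prime P∣ab)

  ∤-^ : ∀ {a} → P ∤ a → ∀ k → P ∤ a ^ k
  ∤-^ P∤a zero    = ∤-1
  ∤-^ P∤a (suc k) = ∤-* P∤a (∤-^ P∤a k)

  ∤-! : ∀ k → k < P → P ∤ k !
  ∤-! zero    _   = ∤-1
  ∤-! (suc k) k<P = ∤-* (∤-small z<s k<P) (∤-! k (<-trans (n<1+n k) k<P))

module Congruence (P : ℕ) where
  open import Data.Nat.Divisibility using (_∤_) renaming (_∣_ to _∣ℕ_)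
  open import Data.Nat.Primality using (Prime; euclidsLemma)
  open import Data.Integer using (ℤ; +_; _+_; _*_; _-_; -_; ∣_∣)
  open import Data.Integer.Properties using (abs-*; +-identityʳ)
  open import Data.Integer.Divisibility.Signed as Signed
    using (divides; ∣m⇒∣-m; ∣m∣n⇒∣m+n; ∣n⇒∣m*n; ∣m⇒∣m*n; ∣⇒∣ᵤ; ∣ᵤ⇒∣)
  open import Data.Integer.Tactic.RingSolver using (solve-∀)
  open import Data.Sum using ([_,_])
  open import Data.Empty using (⊥-elim)
  open import Function using (_∘_; id)
  open import Relation.Binary.Bundles using (Setoid)
  open import Relation.Binary.PropositionalEquality using (_≡_; subst; sym)

  infix 4 _≈_

  -- a ≈ b : P divides a - b.  A record, so that a and b can be inferred.
  record _≈_ (a b : ℤ) : Set where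
    constructor mk≈
    field P∣difference : + P Signed.∣ a - b

  private
    P∣_ : ℤ → Set
    P∣ x = + P Signed.∣ x

    along : ∀ {x y} → y ≡ x → P∣ x → P∣ y
    along eq = subst P∣_ (sym eq)

  ≈-multiple : ∀ {a b} k → a - b ≡ k * + P → a ≈ b
  ≈-multiple k eq = mk≈ (divides k eq)

  ≈-refl : ∀ {a} → a ≈ a
  ≈-refl {a} = ≈-multiple (+ 0) (self-difference a (+ P))
    where
    self-difference : ∀ a p → a - a ≡ + 0 * p
    self-difference = solve-∀

  ≈-sym : ∀ {a b} → a ≈ b → b ≈ a
  ≈-sym {a} {b} (mk≈ d) = mk≈ (along (flip a b) (∣m⇒∣-m d))
    where
    flip : ∀ a b → b - a ≡ - (a - b)
    flip = solve-∀

  ≈-trans : ∀ {a b c} → a ≈ b → b ≈ c → a ≈ c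
  ≈-trans {a} {b} {c} (mk≈ d) (mk≈ e) = mk≈ (along (split a b c) (∣m∣n⇒∣m+n d e))
    where
    split : ∀ a b c → a - c ≡ (a - b) + (b - c)
    split = solve-∀

  ≈-setoid : Setoid _ _
  ≈-setoid = record
    { Carrier = ℤ ; _≈_ = _≈_
    ; isEquivalence = record { refl = ≈-refl ; sym = ≈-sym ; trans = ≈-trans } }

  +-cong : ∀ {a b c d} → a ≈ b → c ≈ d → a + c ≈ b + d
  +-cong {a} {b} {c} {d} (mk≈ e) (mk≈ f) = mk≈ (along (split a b c d) (∣m∣n⇒∣m+n e f))
    where
    split : ∀ a b c d → (a + c) - (b + d) ≡ (a - b) + (c - d)
    split = solve-∀

  *-cong : ∀ {a b c d} → a ≈ b → c ≈ d → a * c ≈ b * d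
  *-cong {a} {b} {c} {d} (mk≈ e) (mk≈ f) =
    mk≈ (along (split a b c d) (∣m∣n⇒∣m+n (∣n⇒∣m*n a f) (∣m⇒∣m*n d e)))
    where
    split : ∀ a b c d → a * c - b * d ≡ a * (c - d) + (a - b) * d
    split = solve-∀

  ≈0⇒∣ : ∀ {a} → a ≈ + 0 → + P Signed.∣ a
  ≈0⇒∣ {a} (mk≈ d) = subst P∣_ (+-identityʳ a) d

  *-congˡ : ∀ {a b} c → a ≈ b → c * a ≈ c * b
  *-congˡ c = *-cong (≈-refl {c})

  *-cancelˡ : Prime P → ∀ {a b} c → P ∤ ∣ c ∣ → c * a ≈ c * b → a ≈ b
  *-cancelˡ P-prime {a} {b} c P∤c (mk≈ d) =
    mk≈ (∣ᵤ⇒∣ ([ ⊥-elim ∘ P∤c , id ] (euclidsLemma ∣ c ∣ ∣ a - b ∣ P-prime P∣∣c[a-b]∣)))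
    where
    factor : ∀ c a b → c * a - c * b ≡ c * (a - b)
    factor = solve-∀
    P∣∣c[a-b]∣ : P ∣ℕ ∣ c ∣ ℕ.* ∣ a - b ∣
    P∣∣c[a-b]∣ = subst (P ∣ℕ_) (abs-* c (a - b)) (∣⇒∣ᵤ (subst P∣_ (factor c a b) d))

module Fractions where
  open import Data.Nat as ℕ using (NonZero)
  open import Data.Nat.Divisibility using (_∣_; _∤_; ∣m⇒∣m*n)
  open import Data.Nat.Primality using (Prime; euclidsLemma)
  open import Data.Integer using (ℤ; +_; _+_; _*_; -_; ∣_∣)
  open import Data.Integer.GCD using (gcd)
  open import Data.Integer.Properties using (*-cancelʳ-≡; pos-*; abs-*; *-comm; *-assoc; neg-distribˡ-*)
  open import Data.Integer.Tactic.RingSolver using (solve-∀)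
  open import Data.Rational as ℚ using (ℚ; mkℚ; ↥_; ↧_; ↧ₙ_)
  open import Data.Rational.Properties using (↥-/; ↧-/; ↥-neg; ↧-neg)
  open import Data.Sum using ([_,_])
  open import Data.Empty using (⊥-elim)
  open import Function using (_∘_; id)
  open import Relation.Binary.PropositionalEquality
  open ≡-Reasoning

  infix 4 _≐_/_

  -- x ≐ a / d : the rational x equals the fraction a / d (cross-multiplied).
  -- A record, so that x, a and d can be inferred.
  record _≐_/_ (x : ℚ) (a d : ℤ) : Set where
    constructor cross
    field cross-multiplied : ↥ x * d ≡ a * ↧ x

  open _≐_/_

  ≐-/ : ∀ i d .{{_ : NonZero d}} → (i ℚ./ d) ≐ i / + d
  ≐-/ i d = cross (begin
    ↥ q * + d          ≡⟨ cong (↥ q *_) (↧-/ i d) ⟨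
    ↥ q * (↧ q * g)    ≡⟨ regroup (↥ q) (↧ q) g ⟩
    (↥ q * g) * ↧ q    ≡⟨ cong (_* ↧ q) (↥-/ i d) ⟩
    i * ↧ q            ∎)
    where
    q = i ℚ./ d
    g = gcd i (+ d)
    regroup : ∀ u v g → u * (v * g) ≡ (u * g) * v
    regroup = solve-∀

  ≐-neg : ∀ {x a d} → x ≐ a / d → ℚ.- x ≐ - a / d
  ≐-neg {x} {a} {d} (cross x≐) = cross (begin
    ↥ (ℚ.- x) * d   ≡⟨ cong (_* d) (↥-neg x) ⟩
    (- ↥ x) * d     ≡⟨ neg-distribˡ-* (↥ x) d ⟨
    - (↥ x * d)     ≡⟨ cong -_ x≐ ⟩
    - (a * ↧ x)     ≡⟨ neg-distribˡ-* a (↧ x) ⟩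
    (- a) * ↧ x     ≡⟨ cong ((- a) *_) (↧-neg x) ⟨
    (- a) * ↧ (ℚ.- x) ∎)

  ≐-expand : ∀ {x a d} → x ≐ a / d → ∀ f → x ≐ a * f / (d * f)
  ≐-expand {x} {a} {d} (cross x≐) f = cross (begin
    ↥ x * (d * f)   ≡⟨ *-assoc (↥ x) d f ⟨
    ↥ x * d * f     ≡⟨ cong (_* f) x≐ ⟩
    a * ↧ x * f     ≡⟨ swap a (↧ x) f ⟩
    a * f * ↧ x     ∎)
    where
    swap : ∀ a q f → a * q * f ≡ a * f * q
    swap = solve-∀

  ≐-+ : ∀ {x y a b d} → x ≐ a / d → y ≐ b / d → x ℚ.+ y ≐ (a + b) / d
  ≐-+ {x@(mkℚ _ _ _)} {y@(mkℚ _ _ _)} {a} {b} {d} (cross x≐) (cross y≐) = cross (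
    *-cancelʳ-≡ (↥ s * d) ((a + b) * ↧ s) (↧ x * ↧ y) (begin
      ↥ s * d * (↧ x * ↧ y)                        ≡⟨ regroup (↥ s) d (↧ x * ↧ y) ⟩
      (↥ s * (↧ x * ↧ y)) * d                      ≡⟨ cong (λ t → ↥ s * t * d) (pos-* (↧ₙ x) (↧ₙ y)) ⟨
      (↥ s * + (↧ₙ x ℕ.* ↧ₙ y)) * d                ≡⟨ cong (_* d) (cross-multiplied (≐-/ num (↧ₙ x ℕ.* ↧ₙ y))) ⟩
      num * ↧ s * d                                ≡⟨ expand (↥ x) (↥ y) (↧ x) (↧ y) (↧ s) d ⟩
      ↧ s * ((↥ x * d) * ↧ y + (↥ y * d) * ↧ x)    ≡⟨ cong₂ (λ u v → ↧ s * (u * ↧ y + v * ↧ x)) x≐ y≐ ⟩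
      ↧ s * ((a * ↧ x) * ↧ y + (b * ↧ y) * ↧ x)    ≡⟨ collect a b (↧ s) (↧ x) (↧ y) ⟩
      (a + b) * ↧ s * (↧ x * ↧ y)                  ∎))
    where
    s = x ℚ.+ y
    num = ↥ x * ↧ y + ↥ y * ↧ x
    regroup : ∀ u d q → u * d * q ≡ (u * q) * d
    regroup = solve-∀
    expand : ∀ ux uy dx dy ds d → (ux * dy + uy * dx) * ds * d ≡ ds * ((ux * d) * dy + (uy * d) * dx)
    expand = solve-∀
    collect : ∀ a b ds dx dy → ds * ((a * dx) * dy + (b * dy) * dx) ≡ (a + b) * ds * (dx * dy)
    collect = solve-∀

  ≐-- : ∀ {x y a b d e} → x ≐ a / d → y ≐ b / e → x ℚ.- y ≐ a * e + (- b) * d / (d * e)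
  ≐-- {x} {y} {a} {b} {d} {e} x≐ y≐ = ≐-+ (≐-expand x≐ e)
    (subst (ℚ.- y ≐ (- b) * d /_) (*-comm e d) (≐-expand (≐-neg y≐) d))

  prime∣numerator : ∀ {P x N D} → Prime P → x ≐ N / D → P ∣ ∣ N ∣ → P ∤ ∣ D ∣ → P ∣ ∣ ↥ x ∣
  prime∣numerator {P} {x} {N} {D} P-prime (cross x≐) P∣N P∤D =
    [ id , ⊥-elim ∘ P∤D ] (euclidsLemma ∣ ↥ x ∣ ∣ D ∣ P-prime P∣xD)
    where
    P∣xD : P ∣ ∣ ↥ x ∣ ℕ.* ∣ D ∣
    P∣xD = subst (P ∣_) cross-abs (∣m⇒∣m*n ∣ ↧ x ∣ P∣N)
      where
      cross-abs : ∣ N ∣ ℕ.* ∣ ↧ x ∣ ≡ ∣ ↥ x ∣ ℕ.* ∣ D ∣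
      cross-abs = begin
        ∣ N ∣ ℕ.* ∣ ↧ x ∣   ≡⟨ abs-* N (↧ x) ⟨
        ∣ N * ↧ x ∣         ≡⟨ cong ∣_∣ x≐ ⟨
        ∣ ↥ x * D ∣         ≡⟨ abs-* (↥ x) D ⟩
        ∣ ↥ x ∣ ℕ.* ∣ D ∣   ∎

module ResidueClassSums where
  open import Data.Nat as ℕ using (ℕ; zero; suc; _≤_)
  open import Data.Nat.Properties using (<-≤-trans; m≤n+m; <⇒≤; +-identityʳ; *-distribˡ-+)
  open import Data.Nat.Combinatorics using (_C_; nCk+nC[k+1]≡[n+1]C[k+1]; k>n⇒nCk≡0)
  import Data.Nat.Tactic.RingSolver as ℕ-Solver
  open import Data.Integer using (ℤ; +_; -[1+_]; _+_; _*_; _^_)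
  open import Data.Integer.Properties using (+-comm; pos-+)
  open import Data.Integer.Tactic.RingSolver using (solve-∀)
  open import Data.Product using (_×_; _,_)
  open import Relation.Binary.PropositionalEquality
  open ≡-Reasoning

  -- c₆ n = 2 cos (n π / 3): the period-6 sequence 2, 1, -1, -2, -1, 1.
  c₆ : ℕ → ℤ
  c₆ 0 = + 2
  c₆ 1 = + 1
  c₆ 2 = -[1+ 0 ]
  c₆ 3 = -[1+ 1 ]
  c₆ 4 = -[1+ 0 ]
  c₆ 5 = + 1
  c₆ (suc (suc (suc (suc (suc (suc n)))))) = c₆ n

  -- The recurrence  c₆ n + c₆ (n + 2) = c₆ (n + 1)  (from 1 + ω² = ω, ω⁶ = 1).
  c₆-recurrence : ∀ n → c₆ n + c₆ (2 ℕ.+ n) ≡ c₆ (1 ℕ.+ n)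
  c₆-recurrence 0 = refl
  c₆-recurrence 1 = refl
  c₆-recurrence 2 = refl
  c₆-recurrence 3 = refl
  c₆-recurrence 4 = refl
  c₆-recurrence 5 = refl
  c₆-recurrence (suc (suc (suc (suc (suc (suc n)))))) = c₆-recurrence n

  S : ℕ → ℕ → ℕ → ℕ
  S r n zero    = n C r
  S r n (suc K) = S r n K ℕ.+ n C (r ℕ.+ 3 ℕ.* suc K)

  private
    interchange : ∀ a b c d → (a ℕ.+ b) ℕ.+ (c ℕ.+ d) ≡ (a ℕ.+ c) ℕ.+ (b ℕ.+ d)
    interchange = ℕ-Solver.solve-∀

  S-pascal : ∀ r n K → S (suc r) (suc n) K ≡ S r n K ℕ.+ S (suc r) n K
  S-pascal r n zero    = sym (nCk+nC[k+1]≡[n+1]C[k+1] n r)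
  S-pascal r n (suc K) = begin
    S (suc r) (suc n) K ℕ.+ suc n C suc i
      ≡⟨ cong₂ ℕ._+_ (S-pascal r n K) (sym (nCk+nC[k+1]≡[n+1]C[k+1] n i)) ⟩
    (S r n K ℕ.+ S (suc r) n K) ℕ.+ (n C i ℕ.+ n C suc i)
      ≡⟨ interchange (S r n K) (S (suc r) n K) (n C i) (n C suc i) ⟩
    (S r n K ℕ.+ n C i) ℕ.+ (S (suc r) n K ℕ.+ n C suc i) ∎
    where i = r ℕ.+ 3 ℕ.* suc K

  -- Pascal's rule for the class r = 0, whose predecessor class is r = 2 shifted by one
  -- block; the boundary term C(n, 3K + 2) appears.
  S₀-pascal : ∀ n K → S 0 (suc n) K ℕ.+ n C (2 ℕ.+ 3 ℕ.* K) ≡ S 0 n K ℕ.+ S 2 n K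
  S₀-pascal n zero    = refl
  S₀-pascal n (suc K) = begin
    (S 0 (suc n) K ℕ.+ suc n C (3 ℕ.* suc K)) ℕ.+ n C j′
      ≡⟨ cong (λ t → (S 0 (suc n) K ℕ.+ t) ℕ.+ n C j′) (sym (nCk+nC[k+1]≡[n+1]C[k+1] n i)) ⟩
    (S 0 (suc n) K ℕ.+ (n C i ℕ.+ n C (3 ℕ.* suc K))) ℕ.+ n C j′
      ≡⟨ cong (λ t → (S 0 (suc n) K ℕ.+ (n C t ℕ.+ n C (3 ℕ.* suc K))) ℕ.+ n C j′) (block K) ⟩
    (S 0 (suc n) K ℕ.+ (n C j ℕ.+ n C (3 ℕ.* suc K))) ℕ.+ n C j′
      ≡⟨ regroup (S 0 (suc n) K) (n C j) (n C (3 ℕ.* suc K)) (n C j′) ⟩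
    ((S 0 (suc n) K ℕ.+ n C j) ℕ.+ n C (3 ℕ.* suc K)) ℕ.+ n C j′
      ≡⟨ cong (λ t → (t ℕ.+ n C (3 ℕ.* suc K)) ℕ.+ n C j′) (S₀-pascal n K) ⟩
    ((S 0 n K ℕ.+ S 2 n K) ℕ.+ n C (3 ℕ.* suc K)) ℕ.+ n C j′
      ≡⟨ regroup′ (S 0 n K) (S 2 n K) (n C (3 ℕ.* suc K)) (n C j′) ⟩
    (S 0 n K ℕ.+ n C (3 ℕ.* suc K)) ℕ.+ (S 2 n K ℕ.+ n C j′) ∎
    where
    i  = K ℕ.+ (suc K ℕ.+ (suc K ℕ.+ 0))
    j  = 2 ℕ.+ 3 ℕ.* K
    j′ = 2 ℕ.+ 3 ℕ.* suc K
    block : ∀ K → K ℕ.+ (suc K ℕ.+ (suc K ℕ.+ 0)) ≡ 2 ℕ.+ 3 ℕ.* K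
    block = ℕ-Solver.solve-∀
    regroup : ∀ s a b c → (s ℕ.+ (a ℕ.+ b)) ℕ.+ c ≡ ((s ℕ.+ a) ℕ.+ b) ℕ.+ c
    regroup = ℕ-Solver.solve-∀
    regroup′ : ∀ a b c d → ((a ℕ.+ b) ℕ.+ c) ℕ.+ d ≡ (a ℕ.+ c) ℕ.+ (b ℕ.+ d)
    regroup′ = ℕ-Solver.solve-∀

  S-row₀ : ∀ r K → S r 0 K ≡ 0 C r
  S-row₀ r zero    = refl
  S-row₀ r (suc K) = begin
    S r 0 K ℕ.+ 0 C (r ℕ.+ 3 ℕ.* suc K)  ≡⟨ cong₂ ℕ._+_ (S-row₀ r K) (k>n⇒nCk≡0 0<r+3[K+1]) ⟩
    0 C r ℕ.+ 0                          ≡⟨ +-identityʳ (0 C r) ⟩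
    0 C r                                ∎
    where
    0<r+3[K+1] : 0 ℕ.< r ℕ.+ 3 ℕ.* suc K
    0<r+3[K+1] = <-≤-trans ℕ.z<s (m≤n+m (3 ℕ.* suc K) r)

  private
    add-rows : ∀ n x y {a b} → + (3 ℕ.* x) ≡ (+ 2) ^ n + a → + (3 ℕ.* y) ≡ (+ 2) ^ n + b →
               + (3 ℕ.* (x ℕ.+ y)) ≡ (+ 2) ^ suc n + (a + b)
    add-rows n x y {a} {b} 3x 3y = begin
      + (3 ℕ.* (x ℕ.+ y))           ≡⟨ cong +_ (*-distribˡ-+ 3 x y) ⟩
      + (3 ℕ.* x ℕ.+ 3 ℕ.* y)       ≡⟨ pos-+ (3 ℕ.* x) (3 ℕ.* y) ⟩
      + (3 ℕ.* x) + + (3 ℕ.* y)     ≡⟨ cong₂ _+_ 3x 3y ⟩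
      ((+ 2) ^ n + a) + ((+ 2) ^ n + b) ≡⟨ double ((+ 2) ^ n) a b ⟩
      + 2 * (+ 2) ^ n + (a + b)       ∎
      where
      double : ∀ t a b → (t + a) + (t + b) ≡ + 2 * t + (a + b)
      double = solve-∀

  -- The three residue-class sums of row n, valid once the sums run past the end of the
  -- row (n ≤ 3K + 2):  3 S_r(n) = 2^n + c₆ (n - 2r).
  residue-sums : ∀ n K → n ≤ 2 ℕ.+ 3 ℕ.* K →
      (+ (3 ℕ.* S 0 n K) ≡ (+ 2) ^ n + c₆ n)
    × (+ (3 ℕ.* S 1 n K) ≡ (+ 2) ^ n + c₆ (4 ℕ.+ n))
    × (+ (3 ℕ.* S 2 n K) ≡ (+ 2) ^ n + c₆ (2 ℕ.+ n))
  residue-sums zero K _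
    rewrite S-row₀ 0 K | S-row₀ 1 K | S-row₀ 2 K = refl , refl , refl
  residue-sums (suc n) K n<3K+2 with residue-sums n K (<⇒≤ n<3K+2)
  ... | row₀ , row₁ , row₂ =
      next S₀-step                  (add-rows n (S 0 n K) (S 2 n K) row₀ row₂)
           (c₆-recurrence n)
    , next (sym (S-pascal 0 n K))   (add-rows n (S 0 n K) (S 1 n K) row₀ row₁)
           (trans (+-comm (c₆ n) _) (c₆-recurrence (4 ℕ.+ n)))
    , next (sym (S-pascal 1 n K))   (add-rows n (S 1 n K) (S 2 n K) row₁ row₂)
           (trans (+-comm (c₆ (4 ℕ.+ n)) _) (c₆-recurrence (2 ℕ.+ n)))
    where
    next : ∀ {x s a c} → x ≡ s → + (3 ℕ.* x) ≡ (+ 2) ^ suc n + a → a ≡ c →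
           + (3 ℕ.* s) ≡ (+ 2) ^ suc n + c
    next refl 3x refl = 3x
    -- the boundary term C(n, 3K + 2) vanishes because n < 3K + 2
    S₀-step : S 0 n K ℕ.+ S 2 n K ≡ S 0 (suc n) K
    S₀-step = begin
      S 0 n K ℕ.+ S 2 n K                              ≡⟨ S₀-pascal n K ⟨
      S 0 (suc n) K ℕ.+ n C (2 ℕ.+ 3 ℕ.* K)            ≡⟨ cong (S 0 (suc n) K ℕ.+_) (k>n⇒nCk≡0 n<3K+2) ⟩
      S 0 (suc n) K ℕ.+ 0                              ≡⟨ +-identityʳ (S 0 (suc n) K) ⟩
      S 0 (suc n) K                                    ∎

module EvenOddProducts where
  open import Data.Nat using (ℕ; zero; suc; _+_; _*_; _^_; _!)
  open import Data.Nat.Properties using (*-identityʳ; *-assoc; +-identityʳ; +-suc)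
  open import Data.Nat.Tactic.RingSolver using (solve-∀)
  open import Data.Sum using (_⊎_; inj₁; inj₂)
  open import Relation.Binary.PropositionalEquality
  open ≡-Reasoning

  evens : ℕ → ℕ
  evens zero    = 1
  evens (suc k) = evens k * (2 * suc k)

  odds : ℕ → ℕ
  odds zero    = 1
  odds (suc k) = odds k * suc (2 * k)

  evensAfter : ℕ → ℕ → ℕ
  evensAfter h zero    = 1
  evensAfter h (suc m) = 2 * suc h * evensAfter (suc h) m

  evens-split : ∀ h m → evens h * evensAfter h m ≡ evens (h + m)
  evens-split h zero    = trans (*-identityʳ (evens h)) (cong evens (sym (+-identityʳ h)))
  evens-split h (suc m) = begin
    evens h * (2 * suc h * evensAfter (suc h) m)  ≡⟨ *-assoc (evens h) (2 * suc h) _ ⟨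
    evens (suc h) * evensAfter (suc h) m          ≡⟨ evens-split (suc h) m ⟩
    evens (suc h + m)                             ≡⟨ cong evens (+-suc h m) ⟨
    evens (h + suc m)                             ∎

  evens≡2^k*k! : ∀ k → evens k ≡ 2 ^ k * k !
  evens≡2^k*k! zero    = refl
  evens≡2^k*k! (suc k) = trans (cong (_* (2 * suc k)) (evens≡2^k*k! k)) (regroup (2 ^ k) (k !) k)
    where
    regroup : ∀ a f k → (a * f) * (2 * suc k) ≡ (2 * a) * (suc k * f)
    regroup = solve-∀

  evens*odds-even : ∀ h → evens h * odds h ≡ (h + h) !
  evens*odds-even zero    = refl
  evens*odds-even (suc h) = begin
    evens (suc h) * odds (suc h)                          ≡⟨ regroup (evens h) (odds h) h ⟩
    suc (h + suc h) * (suc (h + h) * (evens h * odds h))  ≡⟨ cong (λ t → suc (h + suc h) * (suc (h + h) * t)) (evens*odds-even h) ⟩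
    suc (h + suc h) * (suc (h + h) * (h + h) !)           ≡⟨ cong (λ t → suc (h + suc h) * t !) (+-suc h h) ⟨
    (suc h + suc h) !                                     ∎
    where
    regroup : ∀ e o h → (e * (2 * suc h)) * (o * suc (2 * h)) ≡ suc (h + suc h) * (suc (h + h) * (e * o))
    regroup = solve-∀

  evens*odds-odd : ∀ h → evens h * odds (suc h) ≡ (h + suc h) !
  evens*odds-odd h = begin
    evens h * (odds h * suc (2 * h))   ≡⟨ regroup (evens h) (odds h) h ⟩
    suc (h + h) * (evens h * odds h)   ≡⟨ cong (suc (h + h) *_) (evens*odds-even h) ⟩
    suc (h + h) !                      ≡⟨ cong _! (+-suc h h) ⟨
    (h + suc h) !                      ∎
    where
    regroup : ∀ e o h → e * (o * suc (2 * h)) ≡ suc (h + h) * (e * o)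
    regroup = solve-∀

  evens*odds : ∀ h m → m ≡ h ⊎ m ≡ suc h → evens h * odds m ≡ (h + m) !
  evens*odds h _ (inj₁ refl) = evens*odds-even h
  evens*odds h _ (inj₂ refl) = evens*odds-odd h

module Series where
  open import Data.Nat as ℕ using (ℕ; zero; suc; _^_)
  open import Data.Nat.Properties using (*-suc; m^n≢0)
  open import Data.Nat.Combinatorics using (_C_)
  open import Data.Integer using (ℤ; +_; -[1+_]; _*_; _+_)
  open import Data.Integer.Properties using (*-comm; pos-*)
  open import Data.Integer.Tactic.RingSolver using (solve-∀)
  open import Relation.Binary.PropositionalEquality
  open Fractions

  t : ℕ → ℤ
  t k = sgn k * + ((6 ℕ.* k) C (3 ℕ.* k))

  A : ℕ → ℤ
  A zero    = t 0
  A (suc K) = + 64 * A K + t (suc K)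

  partial-sum-fraction : ∀ K → sumTo K term ≐ A K / + (64 ^ K)
  partial-sum-fraction zero    = ≐-/ (t 0) 1
  partial-sum-fraction (suc K) = ≐-+ previous (≐-/ (t (suc K)) (64 ^ suc K) {{m^n≢0 64 (suc K)}})
    where
    previous : sumTo K term ≐ + 64 * A K / + (64 ^ suc K)
    previous = subst₂ (sumTo K term ≐_/_) (*-comm (A K) (+ 64))
                 (trans (*-comm (+ (64 ^ K)) (+ 64)) (sym (pos-* 64 (64 ^ K))))
                 (≐-expand (partial-sum-fraction K) (+ 64))

  sgn*[-4]^3j : ∀ j → sgn j * -[1+ 3 ] ℤ.^ (3 ℕ.* j) ≡ + (64 ^ j)
  sgn*[-4]^3j zero    = refl
  sgn*[-4]^3j (suc j) = begin
    sgn (suc j) * -[1+ 3 ] ℤ.^ (3 ℕ.* suc j)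
      ≡⟨ cong (λ e → sgn (suc j) * -[1+ 3 ] ℤ.^ e) (*-suc 3 j) ⟩
    -[1+ 0 ] * s * (-[1+ 3 ] * (-[1+ 3 ] * (-[1+ 3 ] * w)))
      ≡⟨ cube s w ⟩
    + 64 * (s * w)
      ≡⟨ cong (+ 64 *_) (sgn*[-4]^3j j) ⟩
    + 64 * + (64 ^ j)
      ≡⟨ pos-* 64 (64 ^ j) ⟨
    + (64 ^ suc j) ∎
    where
    open ≡-Reasoning
    s = sgn j
    w = -[1+ 3 ] ℤ.^ (3 ℕ.* j)
    cube : ∀ s w → -[1+ 0 ] * s * (-[1+ 3 ] * (-[1+ 3 ] * (-[1+ 3 ] * w))) ≡ + 64 * (s * w)
    cube = solve-∀

module ModuloOddPrime (n : ℕ) (P-prime : Prime (ℕ.suc (n ℕ.+ n))) where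
  open import Data.Nat as ℕ using (ℕ; zero; suc; _≤_; _<_; _!; z<s; s≤s; z≤n)
  open import Data.Nat.Properties
    using (+-suc; m+n∸m≡n; m+[n∸m]≡n; m≤m+n; ≤-trans; <-trans; ≤-reflexive; *-comm; *-monoʳ-≤; n≤1+n; n<1+n)
  open import Data.Nat.Divisibility using (_∤_)
  open import Data.Nat.Combinatorics using (_C_)
  open import Data.Nat.Tactic.RingSolver as ℕ-Solver using ()
  open import Data.Integer as ℤ using (+_; -[1+_]; _+_; _*_; _-_; -_; _^_)
  open import Data.Integer.Properties using (pos-+; pos-*; *-assoc; abs-*)
  open import Data.Integer.Divisibility.Signed using (∣⇒∣ᵤ)
  open import Data.Product using (proj₁)
  open import Data.Integer.Tactic.RingSolver using (solve-∀)
  open import Data.Sum using (_⊎_)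
  open import Relation.Binary.PropositionalEquality using (_≡_; refl; cong; cong₂; sym; trans; subst; module ≡-Reasoning)
  import Relation.Binary.Reasoning.Setoid
  open BinomialIdentities
  open EvenOddProducts
  open PrimeNonDivisibility P-prime

  P : ℕ
  P = suc (n ℕ.+ n)

  open Congruence P
  module ≈-Reasoning = Relation.Binary.Reasoning.Setoid ≈-setoid

  n<P : n < P
  n<P = s≤s (m≤m+n n n)

  private
    twice-modulus : ∀ m r → m ℕ.+ suc r ≡ n →
                    + (2 ℕ.* suc (m ℕ.+ m)) + + 4 * + suc r ≡ + 2 * + P
    twice-modulus m r e = begin
      + a + + 4 * + suc r      ≡⟨ cong (λ x → + a + x) (pos-* 4 (suc r)) ⟨
      + a + + (4 ℕ.* suc r)    ≡⟨ pos-+ a (4 ℕ.* suc r) ⟨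
      + (a ℕ.+ 4 ℕ.* suc r)    ≡⟨ cong +_ (trans (in-ℕ m r) (cong (λ k → 2 ℕ.* suc (k ℕ.+ k)) e)) ⟩
      + (2 ℕ.* P)              ≡⟨ pos-* 2 P ⟩
      + 2 * + P                ∎
      where
      open ≡-Reasoning
      a = 2 ℕ.* suc (m ℕ.+ m)
      in-ℕ : ∀ m r → 2 ℕ.* suc (m ℕ.+ m) ℕ.+ 4 ℕ.* suc r ≡ 2 ℕ.* suc ((m ℕ.+ suc r) ℕ.+ (m ℕ.+ suc r))
      in-ℕ = ℕ-Solver.solve-∀

    absorb : ∀ m r → m ℕ.+ suc r ≡ n → + suc m * + (n C suc m) ≡ + suc r * + (n C m)
    absorb m r e = begin
      + suc m * + (n C suc m)       ≡⟨ pos-* (suc m) (n C suc m) ⟨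
      + (suc m ℕ.* (n C suc m))       ≡⟨ cong +_ (C-absorb n m) ⟩
      + ((n ℕ.∸ m) ℕ.* (n C m))       ≡⟨ cong (λ k → + (k ℕ.* (n C m))) n∸m≡1+r ⟩
      + (suc r ℕ.* (n C m))           ≡⟨ pos-* (suc r) (n C m) ⟩
      + suc r * + (n C m)           ∎
      where
      open ≡-Reasoning
      n∸m≡1+r : n ℕ.∸ m ≡ suc r
      n∸m≡1+r = trans (cong (ℕ._∸ m) (sym e)) (m+n∸m≡n m (suc r))

    central : ∀ m → + suc m * + ((suc m ℕ.+ suc m) C suc m) ≡ + (2 ℕ.* suc (m ℕ.+ m)) * + ((m ℕ.+ m) C m)
    central m = trans (sym (pos-* (suc m) _)) (trans (cong +_ (C-central m)) (pos-* (2 ℕ.* suc (m ℕ.+ m)) _))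

  central-binomial : ∀ m r → m ℕ.+ r ≡ n → + ((m ℕ.+ m) C m) ≈ -[1+ 3 ] ^ m * + (n C m)
  central-binomial zero    r _ = ≈-refl
  central-binomial (suc m) r e =
    *-cancelˡ P-prime (+ suc m) (∤-small z<s 1+m<P) (begin
      + suc m * + ((suc m ℕ.+ suc m) C suc m)   ≡⟨ central m ⟩
      + a * + ((m ℕ.+ m) C m)                   ≈⟨ *-congˡ (+ a) (central-binomial m (suc r) e′) ⟩
      + a * (w * + (n C m))                     ≈⟨ ≈-multiple (w * + (n C m) * + 2) multiple-of-P ⟩
      -[1+ 3 ] * w * (+ suc r * + (n C m))      ≡⟨ cong (λ x → -[1+ 3 ] * w * x) (absorb m r e′) ⟨
      -[1+ 3 ] * w * (+ suc m * + (n C suc m))  ≡⟨ regroup (+ suc m) -[1+ 3 ] w (+ (n C suc m)) ⟩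
      + suc m * (-[1+ 3 ] ^ suc m * + (n C suc m)) ∎)
    where
    open ≈-Reasoning
    w = -[1+ 3 ] ^ m
    a = 2 ℕ.* suc (m ℕ.+ m)
    e′ : m ℕ.+ suc r ≡ n
    e′ = trans (+-suc m r) e
    1+m<P : suc m < P
    1+m<P = ≤-trans (s≤s (≤-trans (m≤m+n (suc m) r) (≤-reflexive e))) n<P
    -- the two sides differ by  w C(n, m) (2(2m + 1) + 4(r + 1)) = 2 w C(n, m) P
    multiple-of-P : + a * (w * + (n C m)) - -[1+ 3 ] * w * (+ suc r * + (n C m)) ≡ w * + (n C m) * + 2 * + P
    multiple-of-P = trans (factor (+ a) w (+ (n C m)) (+ suc r))
                          (trans (cong (λ x → w * + (n C m) * x) (twice-modulus m r e′))
                                 (reassoc w (+ (n C m)) (+ P)))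
      where
      factor : ∀ a w z r → a * (w * z) - -[1+ 3 ] * w * (r * z) ≡ w * z * (a + + 4 * r)
      factor = solve-∀
      reassoc : ∀ w z p → w * z * (+ 2 * p) ≡ w * z * + 2 * p
      reassoc = solve-∀
    regroup : ∀ s c w y → c * w * (s * y) ≡ s * (c * w * y)
    regroup = solve-∀

  private
    even+odd≡P : ∀ h m → h ℕ.+ suc m ≡ n → + (2 ℕ.* suc h) + + suc (2 ℕ.* m) ≡ + P
    even+odd≡P h m e = trans (sym (pos-+ (2 ℕ.* suc h) (suc (2 ℕ.* m))))
                             (cong +_ (trans (in-ℕ h m) (cong (λ k → suc (k ℕ.+ k)) e)))
      where
      in-ℕ : ∀ h m → 2 ℕ.* suc h ℕ.+ suc (2 ℕ.* m) ≡ suc ((h ℕ.+ suc m) ℕ.+ (h ℕ.+ suc m))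
      in-ℕ = ℕ-Solver.solve-∀

    pos-^ : ∀ a k → + (a ℕ.^ k) ≡ (+ a) ^ k
    pos-^ a zero    = refl
    pos-^ a (suc k) = trans (pos-* a (a ℕ.^ k)) (cong (+ a *_) (pos-^ a k))

  -- The even numbers 2h + 2, …, 2n are, modulo P = 2n + 1, the negatives of the odd
  -- numbers 2m - 1, …, 1 (where h + m = n).
  evensAfter-mod : ∀ h m → h ℕ.+ m ≡ n → + evensAfter h m ≈ sgn m * + odds m
  evensAfter-mod h zero    _ = ≈-refl
  evensAfter-mod h (suc m) e = begin
    + (2 ℕ.* suc h ℕ.* evensAfter (suc h) m)    ≡⟨ pos-* (2 ℕ.* suc h) _ ⟩
    + (2 ℕ.* suc h) * + evensAfter (suc h) m    ≈⟨ *-congˡ (+ (2 ℕ.* suc h)) (evensAfter-mod (suc h) m (trans (sym (+-suc h m)) e)) ⟩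
    + (2 ℕ.* suc h) * (sgn m * + odds m)        ≈⟨ ≈-multiple (sgn m * + odds m) multiple-of-P ⟩
    -[1+ 0 ] * sgn m * (+ odds m * + suc (2 ℕ.* m)) ≡⟨ cong (-[1+ 0 ] * sgn m *_) (pos-* (odds m) _) ⟨
    sgn (suc m) * + odds (suc m)                ∎
    where
    open ≈-Reasoning
    multiple-of-P : + (2 ℕ.* suc h) * (sgn m * + odds m) - -[1+ 0 ] * sgn m * (+ odds m * + suc (2 ℕ.* m))
                    ≡ sgn m * + odds m * + P
    multiple-of-P = trans (factor (+ (2 ℕ.* suc h)) (sgn m) (+ odds m) (+ suc (2 ℕ.* m)))
                          (cong (sgn m * + odds m *_) (even+odd≡P h m e))
      where
      factor : ∀ a s o b → a * (s * o) - -[1+ 0 ] * s * (o * b) ≡ s * o * (a + b)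
      factor = solve-∀

  2^n≈sgn : ∀ h m → h ℕ.+ m ≡ n → m ≡ h ⊎ m ≡ suc h → (+ 2) ^ n ≈ sgn m
  2^n≈sgn h m e shape = *-cancelˡ P-prime (+ (n !)) (∤-! n n<P) (begin
    + (n !) * (+ 2) ^ n               ≡⟨ cong (+ (n !) *_) (pos-^ 2 n) ⟨
    + (n !) * + (2 ℕ.^ n)             ≡⟨ pos-* (n !) (2 ℕ.^ n) ⟨
    + (n ! ℕ.* 2 ℕ.^ n)               ≡⟨ cong +_ (trans (*-comm (n !) _) (sym (evens≡2^k*k! n))) ⟩
    + evens n                         ≡⟨ cong (λ k → + evens k) e ⟨
    + evens (h ℕ.+ m)                 ≡⟨ cong +_ (evens-split h m) ⟨
    + (evens h ℕ.* evensAfter h m)    ≡⟨ pos-* (evens h) _ ⟩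
    + evens h * + evensAfter h m      ≈⟨ *-congˡ (+ evens h) (evensAfter-mod h m e) ⟩
    + evens h * (sgn m * + odds m)    ≡⟨ swap (+ evens h) (sgn m) (+ odds m) ⟩
    + evens h * + odds m * sgn m      ≡⟨ cong (_* sgn m) (pos-* (evens h) (odds m)) ⟨
    + (evens h ℕ.* odds m) * sgn m    ≡⟨ cong (λ k → + k * sgn m) (trans (evens*odds h m shape) (cong _! e)) ⟩
    + (n !) * sgn m                   ∎)
    where
    open ≈-Reasoning
    swap : ∀ e s o → e * (s * o) ≡ e * o * s
    swap = solve-∀

  open Series
  open ResidueClassSums using (S; c₆; residue-sums)

  t-mod : ∀ j → 3 ℕ.* j ≤ n → t j ≈ + (64 ℕ.^ j) * + (n C (3 ℕ.* j))
  t-mod j 3j≤n = begin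
    sgn j * + ((6 ℕ.* j) C i)                ≡⟨ cong (λ k → sgn j * + (k C i)) (six j) ⟩
    sgn j * + ((i ℕ.+ i) C i)                ≈⟨ *-congˡ (sgn j) (central-binomial i (n ℕ.∸ i) (m+[n∸m]≡n 3j≤n)) ⟩
    sgn j * (-[1+ 3 ] ^ i * + (n C i))       ≡⟨ *-assoc (sgn j) _ _ ⟨
    sgn j * -[1+ 3 ] ^ i * + (n C i)         ≡⟨ cong (_* + (n C i)) (sgn*[-4]^3j j) ⟩
    + (64 ℕ.^ j) * + (n C i)                 ∎
    where
    open ≈-Reasoning
    i = 3 ℕ.* j
    six : ∀ j → 6 ℕ.* j ≡ 3 ℕ.* j ℕ.+ 3 ℕ.* j
    six = ℕ-Solver.solve-∀

  A-mod : ∀ K → 3 ℕ.* K ≤ n → A K ≈ + (64 ℕ.^ K) * + S 0 n K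
  A-mod zero    _     = t-mod 0 z≤n
  A-mod (suc K) 3K≤n = begin
    + 64 * A K + t (suc K)
      ≈⟨ +-cong (*-congˡ (+ 64) (A-mod K (≤-trans (*-monoʳ-≤ 3 (n≤1+n K)) 3K≤n))) (t-mod (suc K) 3K≤n) ⟩
    + 64 * (w * + S 0 n K) + + (64 ℕ.^ suc K) * + c
      ≡⟨ cong (λ x → + 64 * (w * + S 0 n K) + x * + c) (pos-* 64 (64 ℕ.^ K)) ⟩
    + 64 * (w * + S 0 n K) + + 64 * w * + c
      ≡⟨ collect w (+ S 0 n K) (+ c) ⟩
    + 64 * w * (+ S 0 n K + + c)
      ≡⟨ cong₂ _*_ (pos-* 64 (64 ℕ.^ K)) (pos-+ (S 0 n K) c) ⟨
    + (64 ℕ.^ suc K) * + S 0 n (suc K) ∎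
    where
    open ≈-Reasoning
    w = + (64 ℕ.^ K)
    c = n C (3 ℕ.* suc K)
    collect : ∀ w s c → + 64 * (w * s) + + 64 * w * c ≡ + 64 * w * (s + c)
    collect = solve-∀

  open Fractions

  sum-congruence : 3 < P → ∀ h m K → h ℕ.+ m ≡ n → m ≡ h ⊎ m ≡ suc h →
                   3 ℕ.* K ≤ n → n ≤ 2 ℕ.+ 3 ℕ.* K →
                   sumTo K term ≡ (sgn m + c₆ n) ℚ./ 3 [modℚ P ]
  sum-congruence 3<P h m K e shape 3K≤n n≤3K+2 =
    prime∣numerator P-prime (≐-- (partial-sum-fraction K) (≐-/ b 3))
                    (∣⇒∣ᵤ (≈0⇒∣ numerator≈0)) P∤denominator
    where
    b = sgn m + c₆ n
    w = + (64 ℕ.^ K)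
    three-S : w * + S 0 n K * + 3 ≡ w * ((+ 2) ^ n + c₆ n)
    three-S = trans (reassoc w (+ S 0 n K))
                    (cong (w *_) (trans (sym (pos-* 3 (S 0 n K))) (proj₁ (residue-sums n K n≤3K+2))))
      where
      reassoc : ∀ w s → w * s * + 3 ≡ w * (+ 3 * s)
      reassoc = solve-∀
    numerator≈0 : A K * + 3 + (- b) * w ≈ + 0
    numerator≈0 = begin
      A K * + 3 + (- b) * w                  ≈⟨ +-cong (*-cong (A-mod K 3K≤n) ≈-refl) ≈-refl ⟩
      w * + S 0 n K * + 3 + (- b) * w        ≡⟨ cong (_+ (- b) * w) three-S ⟩
      w * ((+ 2) ^ n + c₆ n) + (- b) * w     ≈⟨ +-cong (*-congˡ w (+-cong (2^n≈sgn h m e shape) ≈-refl)) ≈-refl ⟩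
      w * b + (- b) * w                      ≡⟨ cancel w b ⟩
      + 0                                    ∎
      where
      open ≈-Reasoning
      cancel : ∀ w b → w * b + (- b) * w ≡ + 0
      cancel = solve-∀
    P∤denominator : P ∤ ℤ.∣ w * + 3 ∣
    P∤denominator = subst (P ∤_) (sym (abs-* w (+ 3)))
                      (∤-* (∤-^ (∤-^ (∤-small z<s 2<P) 6) K) (∤-small z<s 3<P))
      where
      2<P : 2 < P
      2<P = <-trans (n<1+n 2) 3<P

module SignOfC₆ where
  open import Data.Nat as ℕ using (zero; suc)
  open import Data.Nat.Properties using (+-identityʳ; +-comm; suc-injective)
  open import Data.Nat.Divisibility using (divides)
  open import Data.Integer using (+_; -[1+_]; _*_; -_)
  open import Data.Integer.Properties using (neg-distribʳ-*; -1*i≡-i)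
  open import Data.Integer.Tactic.RingSolver using (solve-∀)
  open import Relation.Binary.PropositionalEquality
  open ResidueClassSums using (c₆)

  c₆-antiperiodic : ∀ x → c₆ (3 ℕ.+ x) ≡ - c₆ x
  c₆-antiperiodic 0 = refl
  c₆-antiperiodic 1 = refl
  c₆-antiperiodic 2 = refl
  c₆-antiperiodic 3 = refl
  c₆-antiperiodic 4 = refl
  c₆-antiperiodic 5 = refl
  c₆-antiperiodic (suc (suc (suc (suc (suc (suc x)))))) = c₆-antiperiodic x

  sgn-antiperiodic : ∀ x → sgn (3 ℕ.+ x) ≡ - sgn x
  sgn-antiperiodic x = cube (sgn x)
    where
    cube : ∀ s → -[1+ 0 ] * (-[1+ 0 ] * (-[1+ 0 ] * s)) ≡ - s
    cube = solve-∀

  -- Both c₆ and (-1)^n change sign under n ↦ n + 3, so a relation c₆ r = k (-1)^r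
  -- propagates to the whole residue class of r.
  c₆-on-class : ∀ k r → c₆ r ≡ k * sgn r → ∀ q → c₆ (q ℕ.* 3 ℕ.+ r) ≡ k * sgn (q ℕ.* 3 ℕ.+ r)
  c₆-on-class k r base zero    = base
  c₆-on-class k r base (suc q) = begin
    c₆ (3 ℕ.+ x)         ≡⟨ c₆-antiperiodic x ⟩
    - c₆ x               ≡⟨ cong -_ (c₆-on-class k r base q) ⟩
    - (k * sgn x)        ≡⟨ neg-distribʳ-* k (sgn x) ⟩
    k * - sgn x          ≡⟨ cong (k *_) (sgn-antiperiodic x) ⟨
    k * sgn (3 ℕ.+ x)    ∎
    where
    open ≡-Reasoning
    x = q ℕ.* 3 ℕ.+ r

  c₆-when-3∣n : ∀ {n} → 3 ∣ n → c₆ n ≡ + 2 * sgn n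
  c₆-when-3∣n (divides q refl) =
    subst (λ x → c₆ x ≡ + 2 * sgn x) (+-identityʳ (q ℕ.* 3)) (c₆-on-class (+ 2) 0 refl q)

  c₆-when-3∣n+1 : ∀ {n} → 3 ∣ suc n → c₆ n ≡ - sgn n
  c₆-when-3∣n+1 {n} (divides (suc q) 1+n≡3+3q) =
    subst (λ x → c₆ x ≡ - sgn x) (sym n≡3q+2)
      (trans (c₆-on-class -[1+ 0 ] 2 refl q) (-1*i≡-i (sgn (q ℕ.* 3 ℕ.+ 2))))
    where
    n≡3q+2 : n ≡ q ℕ.* 3 ℕ.+ 2
    n≡3q+2 = trans (suc-injective 1+n≡3+3q) (+-comm 2 (q ℕ.* 3))

module OddArithmetic where
  open import Data.Nat as ℕ using (ℕ; zero; suc; _+_; _*_; _≤_; _%_; z<s; s<s)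
  open import Data.Nat.Properties
    using (≤-trans; ≤-reflexive; ≤-pred; *-comm; +-mono-≤; +-identityʳ)
  open import Data.Nat.DivMod using (m≡m%n+[m/n]*n; m%n<n; m/n*n≤m; m*n/n≡m; m*n/m*o≡n/o; +-distrib-/-∣ˡ)
  open import Data.Nat.Divisibility using (divides; _∤_; ∣m+n∣m⇒∣n; n∣m*n)
  open import Data.Nat.Primality using (Prime; composite)
  import Data.Nat.Tactic.RingSolver as ℕ-Solver
  open import Data.Product using (_,_)
  open import Data.Sum using (_⊎_; inj₁; inj₂)
  open import Data.Empty using (⊥-elim)
  open import Relation.Binary.PropositionalEquality

  third-bounds : ∀ n → 3 * (n / 3) ≤ n × n ≤ 2 + 3 * (n / 3)
  third-bounds n = ≤-trans (≤-reflexive (*-comm 3 (n / 3))) (m/n*n≤m n 3)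
                 , ≤-trans (≤-reflexive (m≡m%n+[m/n]*n n 3))
                           (+-mono-≤ (≤-pred (m%n<n n 3)) (≤-reflexive (*-comm (n / 3) 3)))

  [n+n]/6≡n/3 : ∀ n → (n + n) / 6 ≡ n / 3
  [n+n]/6≡n/3 n = trans (cong (_/ 6) (double n)) (m*n/m*o≡n/o 2 n 3)
    where
    double : ∀ n → n + n ≡ 2 * n
    double = ℕ-Solver.solve-∀

  [n+n]/2≡n : ∀ n → (n + n) / 2 ≡ n
  [n+n]/2≡n n = trans (cong (_/ 2) (double n)) (m*n/n≡m n 2)
    where
    double : ∀ n → n + n ≡ n * 2
    double = ℕ-Solver.solve-∀

  -- 3 ∣ 2n ⇒ 3 ∣ n, because 3 ∣ 3n = 2n + n.
  3∣2n⇒3∣n : ∀ n → 3 ∣ n + n → 3 ∣ n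
  3∣2n⇒3∣n n 3∣2n = ∣m+n∣m⇒∣n (subst (3 ∣_) (triple n) (n∣m*n n)) 3∣2n
    where
    triple : ∀ n → n * 3 ≡ (n + n) + n
    triple = ℕ-Solver.solve-∀

  -- 3 ∣ 2n - 1 ⇒ 3 ∣ n + 1 (for n > 0), because 3 ∣ 3n = (2n - 1) + (n + 1).
  3∣2n-1⇒3∣n+1 : ∀ n → 0 < n → 3 ∣ (n + n) ∸ 1 → 3 ∣ suc n
  3∣2n-1⇒3∣n+1 (suc k) _ 3∣2n-1 = ∣m+n∣m⇒∣n (subst (3 ∣_) (triple k) (n∣m*n (suc k))) 3∣2n-1
    where
    triple : ∀ k → suc k * 3 ≡ (k + suc k) + suc (suc k)
    triple = ℕ-Solver.solve-∀

  3<2n+1⇒0<n : ∀ n → 3 < suc (n + n) → 0 < n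
  3<2n+1⇒0<n zero    (s<s ())
  3<2n+1⇒0<n (suc n) _ = z<s

  prime⇒odd : ∀ {p} → Prime p → 2 < p → 2 ∤ p
  prime⇒odd p-prime 2<p 2∣p = Prime.notComposite p-prime (composite 2<p 2∣p)

  record OddShape (p : ℕ) : Set where
    field
      h m     : ℕ
      m≡h∨1+h     : m ≡ h ⊎ m ≡ suc h
      p≡2n+1  : p ≡ suc ((h + m) + (h + m))
      quarter : (p + 1) / 4 ≡ m

  odd-shape : ∀ p → 2 ∤ p → OddShape p
  odd-shape p 2∤p = by-residue (p % 4) (p / 4) (m≡m%n+[m/n]*n p 4) (m%n<n p 4)
    where
    by-residue : ∀ r q → p ≡ r + q * 4 → r < 4 → OddShape p
    by-residue 0 q e _ = ⊥-elim (2∤p (divides (q * 2) (trans e (even q))))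
      where
      even : ∀ q → 0 + q * 4 ≡ q * 2 * 2
      even = ℕ-Solver.solve-∀
    by-residue 2 q e _ = ⊥-elim (2∤p (divides (1 + q * 2) (trans e (even q))))
      where
      even : ∀ q → 2 + q * 4 ≡ (1 + q * 2) * 2
      even = ℕ-Solver.solve-∀
    by-residue 1 q e _ = record
      { h = q ; m = q ; m≡h∨1+h = inj₁ refl
      ; p≡2n+1  = trans e (shape q)
      ; quarter = begin
          (p + 1) / 4          ≡⟨ cong (λ x → (x + 1) / 4) e ⟩
          (1 + q * 4 + 1) / 4  ≡⟨ cong (_/ 4) (shift q) ⟩
          (q * 4 + 2) / 4      ≡⟨ +-distrib-/-∣ˡ 2 (n∣m*n q) ⟩
          q * 4 / 4 + 0        ≡⟨ +-identityʳ (q * 4 / 4) ⟩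
          q * 4 / 4            ≡⟨ m*n/n≡m q 4 ⟩
          q                    ∎ }
      where
      open ≡-Reasoning
      shape : ∀ q → 1 + q * 4 ≡ suc ((q + q) + (q + q))
      shape = ℕ-Solver.solve-∀
      shift : ∀ q → 1 + q * 4 + 1 ≡ q * 4 + 2
      shift = ℕ-Solver.solve-∀
    by-residue 3 q e _ = record
      { h = q ; m = suc q ; m≡h∨1+h = inj₂ refl
      ; p≡2n+1  = trans e (shape q)
      ; quarter = begin
          (p + 1) / 4          ≡⟨ cong (λ x → (x + 1) / 4) e ⟩
          (3 + q * 4 + 1) / 4  ≡⟨ cong (_/ 4) (shift q) ⟩
          suc q * 4 / 4        ≡⟨ m*n/n≡m (suc q) 4 ⟩
          suc q                ∎ }
      where
      open ≡-Reasoning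
      shape : ∀ q → 3 + q * 4 ≡ suc ((q + suc q) + (q + suc q))
      shape = ℕ-Solver.solve-∀
      shift : ∀ q → 3 + q * 4 + 1 ≡ suc q * 4
      shift = ℕ-Solver.solve-∀
    by-residue (suc (suc (suc (suc r)))) q e (s<s (s<s (s<s (s<s ()))))

open import Data.Nat.Properties using (<-trans; n<1+n)
open import Data.Product using (_,_; proj₁; proj₂)
open import Relation.Binary.PropositionalEquality using (_≡_; refl; sym; trans; cong; subst; subst₂)
open ResidueClassSums using (c₆)
open SignOfC₆ using (c₆-when-3∣n; c₆-when-3∣n+1)
open OddArithmetic

theorem4p1 : (p : ℕ) → Prime p → 3 < p →
    (3 ∣ p ∸ 1 →
      sumTo ((p ∸ 1) / 6) term ≡ (sgn ((p ℕ.+ 1) / 4) ℤ.+ + 2 ℤ.* sgn ((p ∸ 1) / 2)) ℚ./ 3 [modℚ p ])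
    × (3 ∣ p ∸ 2 →
      sumTo ((p ∸ 1) / 6) term ≡ (sgn ((p ℕ.+ 1) / 4) ℤ.- sgn ((p ∸ 1) / 2)) ℚ./ 3 [modℚ p ])
theorem4p1 p p-prime 3<p with odd-shape p (prime⇒odd p-prime (<-trans (n<1+n 2) 3<p))
... | record { h = h ; m = m ; m≡h∨1+h = m≡h∨1+h ; p≡2n+1 = refl ; quarter = quarter } =
    (λ 3∣2n → conclude (trans (c₆-when-3∣n (3∣2n⇒3∣n n 3∣2n))
                             (cong (λ k → + 2 ℤ.* sgn k) (sym ([n+n]/2≡n n)))))
  , (λ 3∣2n-1 → conclude (trans (c₆-when-3∣n+1 (3∣2n-1⇒3∣n+1 n (3<2n+1⇒0<n n 3<p) 3∣2n-1))
                                (cong (λ k → ℤ.- sgn k) (sym ([n+n]/2≡n n)))))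
  where
  n = h ℕ.+ m
  P = ℕ.suc (n ℕ.+ n)
  main : sumTo (n / 3) term ≡ (sgn m ℤ.+ c₆ n) ℚ./ 3 [modℚ P ]
  main = ModuloOddPrime.sum-congruence n p-prime 3<p h m (n / 3) refl m≡h∨1+h
           (proj₁ (third-bounds n)) (proj₂ (third-bounds n))
  conclude : ∀ {b} → c₆ n ≡ b → sumTo ((n ℕ.+ n) / 6) term ≡ (sgn ((P ℕ.+ 1) / 4) ℤ.+ b) ℚ./ 3 [modℚ P ]
  conclude {b} c₆n≡b =
    subst₂ (λ K e → sumTo K term ≡ (sgn e ℤ.+ b) ℚ./ 3 [modℚ P ]) (sym ([n+n]/6≡n/3 n)) (sym quarter)
      (subst (λ c → sumTo (n / 3) term ≡ (sgn m ℤ.+ c) ℚ./ 3 [modℚ P ]) c₆n≡b main)
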